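{- Let $G$ be an instance of $\mathrm{DkS}(n,k,d,\delta,\gamma)$ with planted set $S$ and weighted adjacency matrix $A$. Then every feasible solution $\{X_i\}_{i=1}^n,I$ of the SDP satisfies \[\sum_{i,j\in V\setminus S}A_{ij}\langle X_i,X_j\rangle\le(2\gamma dk)\Bigl(1-\mathbb E_{i\sim S}\|X_i\|^2\Bigr).\]
   Context: Graphs are weighted undirected $G=(V,E,w)$, $V=[n]$, non-negative weights, with $A_{ij}=w(\{i,j\})$ ($0$ for non-edges); $\rho(V')=\frac12\sum_{i,j\in V'}w(\{i,j\})$. An instance of $\mathrm{DkS}(n,k,d,\delta,\gamma)$ ($k<n$, $d>0$, $0<\delta<1$, $\gamma\ge0$): (1) $V=S\sqcup(V\setminus S)$ with $|S|=k$; each pair in $S\times(V\setminus S)$ independently becomes an edge of weight 1 with probability $p=\delta d/k$; (2) arbitrary non-negative weighted edges are added inside $S$ so that $G[S]$ has average weighted degree $d$; (3) arbitrary non-negative weighted edges are added inside $V\setminus S$ so that $\rho(V')\le\gamma d|V'|$ for every $V'\subseteq V\setminus S$; (4) an adversary may delete any edges added in (1) and (3); (5) the resulting graph is output. The SDP: variables are vectors $X_1,\dots,X_n,I$; maximize $\frac12\sum_{i,j}A_{ij}\langle X_i,X_j\rangle$ subject to $\sum_i\|X_i\|^2=k$; $\sum_j\langle X_i,X_j\rangle\le k\|X_i\|^2$ for all $i$; $0\le\langle X_i,X_j\rangle\le\|X_i\|^2$ for $i\ne j$; $\|X_i\|^2\le1$; $\langle X_i,I\rangle=\|X_i\|^2$;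 $\|I\|^2=1$. $\mathbb E_{i\sim S}$ is the average over $i$ uniform in $S$. -}

module Defs where

open import Level using (Level; _⊔_) renaming (suc to lsuc)
open import Data.Nat using (ℕ; zero; suc)
open import Data.Fin using (Fin)
open Data.Fin using (zero; suc)
open import Data.Fin.Subset using (Subset; ∣_∣)
open import Data.Vec using (lookup)
open import Data.Bool using (Bool; true; false; if_then_else_)
open import Data.Product using (_×_; Σ; ∃; _,_)
open import Data.Sum using (_⊎_)
open import Relation.Nullary using (¬_)
open import Relation.Binary using (Rel; IsTotalOrder)
open import Algebra.Bundles using (CommutativeRing)

-- An ordered field (the real numbers ℝ are a model).
-- Inverse is total with the convention that it is only specified on x ≉ 0.
record OrderedField (c ℓ₁ ℓ₂ : Level) : Set (lsuc (c ⊔ ℓ₁ ⊔ ℓ₂)) where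
  infix 4 _≤_ _<_
  field
    commutativeRing : CommutativeRing c ℓ₁
  open CommutativeRing commutativeRing public
    using (Carrier; _≈_; _+_; _*_; -_; 0#; 1#)
  field
    _≤_          : Rel Carrier ℓ₂
    isTotalOrder : IsTotalOrder _≈_ _≤_
    +-monoˡ-≤    : ∀ {a b} c → a ≤ b → (a + c) ≤ (b + c)
    *-nonneg     : ∀ {a b} → 0# ≤ a → 0# ≤ b → 0# ≤ (a * b)
    0≉1          : ¬ (0# ≈ 1#)
    _⁻¹          : Carrier → Carrier
    ⁻¹-cong      : ∀ {x y} → x ≈ y → (x ⁻¹) ≈ (y ⁻¹)
    ⁻¹-inverse   : ∀ {x} → ¬ (x ≈ 0#) → (x * (x ⁻¹)) ≈ 1#

  _<_ : Rel Carrier (ℓ₁ ⊔ ℓ₂)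
  a < b = (a ≤ b) × ¬ (a ≈ b)

  fromℕ : ℕ → Carrier
  fromℕ zero    = 0#
  fromℕ (suc n) = 1# + fromℕ n

  ½ : Carrier
  ½ = (1# + 1#) ⁻¹

  ∑ : ∀ {n} → (Fin n → Carrier) → Carrier
  ∑ {zero}  f = 0#
  ∑ {suc n} f = f zero + ∑ (λ i → f (suc i))

  ∑∈ : ∀ {n} → Subset n → (Fin n → Carrier) → Carrier
  ∑∈ V' f = ∑ (λ i → if lookup V' i then f i else 0#)

  ∑∉ : ∀ {n} → Subset n → (Fin n → Carrier) → Carrier
  ∑∉ V' f = ∑ (λ i → if lookup V' i then 0# else f i)

  ⟨_,_⟩ : ∀ {m} → (Fin m → Carrier) → (Fin m → Carrier) → Carrier
  ⟨ u , v ⟩ = ∑ (λ l → u l * v l)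

  ‖_‖² : ∀ {m} → (Fin m → Carrier) → Carrier
  ‖ u ‖² = ⟨ u , u ⟩

  IsWeightedGraph : ∀ {n} → (Fin n → Fin n → Carrier) → Set (ℓ₁ ⊔ ℓ₂)
  IsWeightedGraph A = (∀ i j → A i j ≈ A j i) × (∀ i j → 0# ≤ A i j)

  ρ : ∀ {n} → (Fin n → Fin n → Carrier) → Subset n → Carrier
  ρ A V' = ½ * ∑∈ V' (λ i → ∑∈ V' (λ j → A i j))

  _⊆∁_ : ∀ {n} → Subset n → Subset n → Set
  V' ⊆∁ S = ∀ i → lookup V' i ≡ true → lookup S i ≡ false
    where open import Relation.Binary.PropositionalEquality using (_≡_)

  -- A₀ is the graph after steps (1)–(3); A is obtained
  -- from A₀ by the adversary deleting edges added in (1) and (3).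
  IsDkSInstance : (n k : ℕ) (d δ γ : Carrier) (S : Subset n)
                  (A : Fin n → Fin n → Carrier) → Set (c ⊔ ℓ₁ ⊔ ℓ₂)
  IsDkSInstance n k d δ γ S A =
    Σ (Fin n → Fin n → Carrier) λ A₀ →
      IsWeightedGraph A₀ × IsWeightedGraph A
      -- (1) every pair in S × (V∖S) is a non-edge or an edge of weight 1
      -- (a possible outcome of the random choice with p = δd/k)
      × (∀ i j → lookup S i ≡ true → lookup S j ≡ false
                → (A₀ i j ≈ 0#) ⊎ (A₀ i j ≈ 1#))
      × ((fromℕ k ⁻¹) * ∑∈ S (λ i → ∑∈ S (λ j → A₀ i j)) ≈ d)
      × (∀ (V' : Subset n) → V' ⊆∁ S → ρ A₀ V' ≤ (γ * d) * fromℕ ∣ V' ∣)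
      × (∀ i j → lookup S i ≡ true → lookup S j ≡ true → A i j ≈ A₀ i j)
      × (∀ i j → ¬ (lookup S i ≡ true × lookup S j ≡ true)
                → (A i j ≈ A₀ i j) ⊎ (A i j ≈ 0#))
    where open import Relation.Binary.PropositionalEquality using (_≡_)

  IsFeasible : (n k m : ℕ) (X : Fin n → Fin m → Carrier) (I : Fin m → Carrier)
               → Set (ℓ₁ ⊔ ℓ₂)
  IsFeasible n k m X I =
      (∑ (λ i → ‖ X i ‖²) ≈ fromℕ k)
    × (∀ i → ∑ (λ j → ⟨ X i , X j ⟩) ≤ fromℕ k * ‖ X i ‖²)
    × (∀ i j → ¬ (i ≡ j) → (0# ≤ ⟨ X i , X j ⟩) × (⟨ X i , X j ⟩ ≤ ‖ X i ‖²))
    × (∀ i → ‖ X i ‖² ≤ 1#)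
    × (∀ i → ⟨ X i , I ⟩ ≈ ‖ X i ‖²)
    × (‖ I ‖² ≈ 1#)
    where open import Relation.Binary.PropositionalEquality using (_≡_)

  𝔼 : ∀ {n} → (k : ℕ) → Subset n → (Fin n → Carrier) → Carrier
  𝔼 k S f = (fromℕ k ⁻¹) * ∑∈ S f

-- Since ⟨X_i, X_j⟩ ≤ min (‖X_i‖², ‖X_j‖²), the left-hand side is at most
-- ∑_{i,j ∉ S} A_ij min (x_i, x_j) with x_i = ‖X_i‖².  Subtracting the smallest
-- value m of x on a level set T splits this sum into m times the weight of
-- T, which step (3) bounds by 2γd|T|·m, plus the same sum for x − m, which
-- vanishes at the minimiser and so lives on a smaller level set.  By
-- induction (the layer-cake decomposition of min) the sum is at most
-- 2γd ∑_{i ∉ S} x_i, and ∑_{i ∉ S} x_i = k − ∑_{i ∈ S} x_i by feasibility.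
module Submission where

open import Defs
open import Level using (Level; _⊔_)
open import Data.Nat using (ℕ; zero; suc)
import Data.Nat as ℕ
open import Data.Nat.Properties using (n<1+n)
open import Data.Nat.Induction using (<-wellFounded)
open import Data.Fin using (Fin; zero; suc; _≟_)
open import Data.Fin.Subset using (Subset; ∣_∣; _∈_; _⊆_; ∁; Empty; inside; outside)
open import Data.Fin.Subset.Properties using (⊆-refl; x∈∁p⇒x∉p)
open import Data.Vec using ([]; _∷_; lookup; here; there; _[_]≔_)
open import Data.Vec.Properties using (lookup⇒[]=)
open import Data.Bool using (true; false)
open import Data.Bool.Properties using (¬-not; not-¬)
open import Data.Product using (_×_; _,_; ∃-syntax; proj₁; proj₂; map)
open import Data.Sum using (_⊎_; inj₁; inj₂)
open import Function using (_∘_)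
open import Induction.WellFounded using (Acc; acc)
open import Relation.Nullary using (¬_; yes; no; contradiction)
open import Relation.Binary using (IsTotalOrder)
open import Relation.Binary.Bundles using (Poset)
import Relation.Binary.Reasoning.PartialOrder as ≤-Reasoning
open import Relation.Binary.PropositionalEquality as ≡ using (_≡_)
open import Algebra.Bundles using (CommutativeRing)
import Algebra.Properties.Ring as RingProperties
import Algebra.Properties.CommutativeSemigroup as CommutativeSemigroupProperties

p[x]≔outside⊆p : ∀ {n} (p : Subset n) x → p [ x ]≔ outside ⊆ p
p[x]≔outside⊆p (_ ∷ p) zero    (there y∈p) = there y∈p
p[x]≔outside⊆p (_ ∷ p) (suc x) here        = here
p[x]≔outside⊆p (_ ∷ p) (suc x) (there y∈p) = there (p[x]≔outside⊆p p x y∈p)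

x∈p⇒∣p[x]≔outside∣<∣p∣ : ∀ {n} (p : Subset n) {x} → x ∈ p → ∣ p [ x ]≔ outside ∣ ℕ.< ∣ p ∣
x∈p⇒∣p[x]≔outside∣<∣p∣ (_       ∷ p) here        = n<1+n ∣ p ∣
x∈p⇒∣p[x]≔outside∣<∣p∣ (inside  ∷ p) (there x∈p) = ℕ.s≤s (x∈p⇒∣p[x]≔outside∣<∣p∣ p x∈p)
x∈p⇒∣p[x]≔outside∣<∣p∣ (outside ∷ p) (there x∈p) = x∈p⇒∣p[x]≔outside∣<∣p∣ p x∈p

∣p∣≡0⇒Empty : ∀ {n} (p : Subset n) → ∣ p ∣ ≡ 0 → Empty p
∣p∣≡0⇒Empty (outside ∷ p) ∣p∣≡0 (suc i , there i∈p) = ∣p∣≡0⇒Empty p ∣p∣≡0 (i , i∈p)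

∈∁⇒lookup≡false : ∀ {n} {p : Subset n} {x} → x ∈ ∁ p → lookup p x ≡ false
∈∁⇒lookup≡false {p = p} {x} x∈∁p = ¬-not (x∈∁p⇒x∉p x∈∁p ∘ lookup⇒[]= x p)

module OrderedFieldProperties {c ℓ₁ ℓ₂ : Level} (F : OrderedField c ℓ₁ ℓ₂) where
  open OrderedField F
  open CommutativeRing commutativeRing
    using ( refl; sym; trans; reflexive; +-cong; +-congˡ; +-congʳ; *-congˡ; *-congʳ
          ; +-identityˡ; +-identityʳ; -‿inverseʳ; *-identityʳ; *-identityˡ; *-assoc; *-comm
          ; +-comm; distribˡ; zeroˡ; -‿cong; zeroʳ; ring; +-commutativeSemigroup; *-commutativeSemigroup )
  open RingProperties ring using (-‿distribˡ-*; -‿distribʳ-*; -‿involutive; //-rightDividesˡ; \\-leftDividesʳ)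
  open CommutativeSemigroupProperties +-commutativeSemigroup
    using (interchange) renaming (x∙yz≈y∙xz to x+[y+z]≈y+[x+z])
  open CommutativeSemigroupProperties *-commutativeSemigroup
    using () renaming (x∙yz≈y∙xz to x*[y*z]≈y*[x*z])
  open IsTotalOrder isTotalOrder
    using (total; antisym; isPartialOrder) renaming (reflexive to ≤-reflexive; trans to ≤-trans)

  poset : Poset c ℓ₁ ℓ₂
  poset = record { isPartialOrder = isPartialOrder }

  open ≤-Reasoning poset

  ≤-refl : ∀ {a} → a ≤ a
  ≤-refl = ≤-reflexive refl

  +-monoʳ-≤ : ∀ a {b b′} → b ≤ b′ → a + b ≤ a + b′
  +-monoʳ-≤ a {b} {b′} b≤b′ = begin
    a + b   ≈⟨ +-comm a b ⟩
    b + a   ≤⟨ +-monoˡ-≤ a b≤b′ ⟩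
    b′ + a  ≈⟨ +-comm b′ a ⟩
    a + b′  ∎

  +-mono-≤ : ∀ {a a′ b b′} → a ≤ a′ → b ≤ b′ → a + b ≤ a′ + b′
  +-mono-≤ {a′ = a′} {b = b} a≤a′ b≤b′ = ≤-trans (+-monoˡ-≤ b a≤a′) (+-monoʳ-≤ a′ b≤b′)

  x≤y⇒0≤y-x : ∀ {x y} → x ≤ y → 0# ≤ y + - x
  x≤y⇒0≤y-x {x} {y} x≤y = begin
    0#      ≈⟨ -‿inverseʳ x ⟨
    x + - x ≤⟨ +-monoˡ-≤ (- x) x≤y ⟩
    y + - x ∎

  0≤y-x⇒x≤y : ∀ {x y} → 0# ≤ y + - x → x ≤ y
  0≤y-x⇒x≤y {x} {y} 0≤y-x = begin
    x            ≈⟨ +-identityˡ x ⟨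
    0# + x       ≤⟨ +-monoˡ-≤ x 0≤y-x ⟩
    y + - x + x  ≈⟨ //-rightDividesˡ x y ⟩
    y            ∎

  *-monoˡ-≤ : ∀ {a b b′} → 0# ≤ a → b ≤ b′ → a * b ≤ a * b′
  *-monoˡ-≤ {a} {b} {b′} 0≤a b≤b′ = 0≤y-x⇒x≤y (begin
    0#                 ≤⟨ *-nonneg 0≤a (x≤y⇒0≤y-x b≤b′) ⟩
    a * (b′ + - b)     ≈⟨ distribˡ a b′ (- b) ⟩
    a * b′ + a * - b   ≈⟨ +-congˡ (-‿distribʳ-* a b) ⟨
    a * b′ + - (a * b) ∎)

  *-nonpos : ∀ {a b} → 0# ≤ a → b ≤ 0# → a * b ≤ 0#
  *-nonpos {a} 0≤a b≤0 = ≤-trans (*-monoˡ-≤ 0≤a b≤0) (≤-reflexive (zeroʳ a))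

  x*x-nonneg : ∀ x → 0# ≤ x * x
  x*x-nonneg x with total 0# x
  ... | inj₁ 0≤x = *-nonneg 0≤x 0≤x
  ... | inj₂ x≤0 = begin
    0#          ≤⟨ *-nonneg 0≤-x 0≤-x ⟩
    - x * - x   ≈⟨ -‿distribˡ-* x (- x) ⟨
    - (x * - x) ≈⟨ -‿cong (-‿distribʳ-* x x) ⟨
    - - (x * x) ≈⟨ -‿involutive (x * x) ⟩
    x * x       ∎
    where
    0≤-x : 0# ≤ - x
    0≤-x = ≤-trans (x≤y⇒0≤y-x x≤0) (≤-reflexive (+-identityˡ (- x)))

  0≤1 : 0# ≤ 1#
  0≤1 = ≤-trans (x*x-nonneg 1#) (≤-reflexive (*-identityˡ 1#))

  fromℕ-nonneg : ∀ k → 0# ≤ fromℕ k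
  fromℕ-nonneg zero    = ≤-refl
  fromℕ-nonneg (suc k) = ≤-trans (≤-reflexive (sym (+-identityˡ 0#))) (+-mono-≤ 0≤1 (fromℕ-nonneg k))

  1+x≉0 : ∀ {x} → 0# ≤ x → ¬ (1# + x ≈ 0#)
  1+x≉0 {x} 0≤x 1+x≈0 = 0≉1 (antisym 0≤1 (begin
    1#      ≈⟨ +-identityʳ 1# ⟨
    1# + 0# ≤⟨ +-monoʳ-≤ 1# 0≤x ⟩
    1# + x  ≈⟨ 1+x≈0 ⟩
    0#      ∎))

  2*[½*x]≈x : ∀ x → (1# + 1#) * (½ * x) ≈ x
  2*[½*x]≈x x = begin-equality
    (1# + 1#) * (½ * x)  ≈⟨ *-assoc (1# + 1#) ½ x ⟨
    (1# + 1#) * ½ * x    ≈⟨ *-congʳ (⁻¹-inverse (1+x≉0 0≤1)) ⟩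
    1# * x               ≈⟨ *-identityˡ x ⟩
    x                    ∎

  -- 0⁻¹ is unspecified, hence the side condition for k = 0.
  fromℕ*[fromℕ⁻¹*s]≈s : ∀ k s → (k ≡ 0 → s ≈ 0#) → fromℕ k * (fromℕ k ⁻¹ * s) ≈ s
  fromℕ*[fromℕ⁻¹*s]≈s zero    s s≈0 = trans (zeroˡ _) (sym (s≈0 ≡.refl))
  fromℕ*[fromℕ⁻¹*s]≈s (suc k) s _   = begin-equality
    fromℕ (suc k) * (fromℕ (suc k) ⁻¹ * s) ≈⟨ *-assoc _ _ s ⟨
    fromℕ (suc k) * fromℕ (suc k) ⁻¹ * s   ≈⟨ *-congʳ (⁻¹-inverse (1+x≉0 (fromℕ-nonneg k))) ⟩
    1# * s                                 ≈⟨ *-identityˡ s ⟩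
    s                                      ∎

  kept-or-deleted⇒≤ : ∀ {a b} → (a ≈ b) ⊎ (a ≈ 0#) → 0# ≤ b → a ≤ b
  kept-or-deleted⇒≤ (inj₁ a≈b) _   = ≤-reflexive a≈b
  kept-or-deleted⇒≤ (inj₂ a≈0) 0≤b = ≤-trans (≤-reflexive a≈0) 0≤b

  ∑-cong : ∀ {n} {f g : Fin n → Carrier} → (∀ i → f i ≈ g i) → ∑ f ≈ ∑ g
  ∑-cong {zero}  f≈g = refl
  ∑-cong {suc n} f≈g = +-cong (f≈g zero) (∑-cong (f≈g ∘ suc))

  ∑-nonneg : ∀ {n} {f : Fin n → Carrier} → (∀ i → 0# ≤ f i) → 0# ≤ ∑ f
  ∑-nonneg {zero}  _   = ≤-refl
  ∑-nonneg {suc n} 0≤f =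
    ≤-trans (≤-reflexive (sym (+-identityˡ 0#))) (+-mono-≤ (0≤f zero) (∑-nonneg (0≤f ∘ suc)))

  ‖‖²-nonneg : ∀ {m} (u : Fin m → Carrier) → 0# ≤ ‖ u ‖²
  ‖‖²-nonneg u = ∑-nonneg (λ l → x*x-nonneg (u l))

  ⟨⟩-comm : ∀ {m} (u v : Fin m → Carrier) → ⟨ u , v ⟩ ≈ ⟨ v , u ⟩
  ⟨⟩-comm u v = ∑-cong (λ l → *-comm (u l) (v l))

  ∑∈-cong : ∀ {n} (T : Subset n) {f g : Fin n → Carrier}
    → (∀ {i} → i ∈ T → f i ≈ g i) → ∑∈ T f ≈ ∑∈ T g
  ∑∈-cong []            f≈g = refl
  ∑∈-cong (inside  ∷ T) f≈g = +-cong (f≈g here) (∑∈-cong T (f≈g ∘ there))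
  ∑∈-cong (outside ∷ T) f≈g = +-congˡ (∑∈-cong T (f≈g ∘ there))

  ∑∈-mono : ∀ {n} (T : Subset n) {f g : Fin n → Carrier}
    → (∀ {i} → i ∈ T → f i ≤ g i) → ∑∈ T f ≤ ∑∈ T g
  ∑∈-mono []            f≤g = ≤-refl
  ∑∈-mono (inside  ∷ T) f≤g = +-mono-≤ (f≤g here) (∑∈-mono T (f≤g ∘ there))
  ∑∈-mono (outside ∷ T) f≤g = +-monoʳ-≤ 0# (∑∈-mono T (f≤g ∘ there))

  ∑∈-+ : ∀ {n} (T : Subset n) (f g : Fin n → Carrier) → ∑∈ T (λ i → f i + g i) ≈ ∑∈ T f + ∑∈ T g
  ∑∈-+ []            f g = sym (+-identityˡ 0#)
  ∑∈-+ (inside  ∷ T) f g = trans (+-congˡ (∑∈-+ T (f ∘ suc) (g ∘ suc))) (interchange _ _ _ _)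
  ∑∈-+ (outside ∷ T) f g = trans (+-identityˡ _)
    (trans (∑∈-+ T (f ∘ suc) (g ∘ suc)) (sym (+-cong (+-identityˡ _) (+-identityˡ _))))

  ∑∈-*ˡ : ∀ {n} (T : Subset n) a (f : Fin n → Carrier) → ∑∈ T (λ i → a * f i) ≈ a * ∑∈ T f
  ∑∈-*ˡ []            a f = sym (zeroʳ a)
  ∑∈-*ˡ (inside  ∷ T) a f = trans (+-congˡ (∑∈-*ˡ T a (f ∘ suc))) (sym (distribˡ a _ _))
  ∑∈-*ˡ (outside ∷ T) a f =
    trans (+-identityˡ _) (trans (∑∈-*ˡ T a (f ∘ suc)) (*-congˡ (sym (+-identityˡ _))))

  ∑∈-const : ∀ {n} (T : Subset n) a → ∑∈ T (λ _ → a) ≈ a * fromℕ ∣ T ∣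
  ∑∈-const []            a = sym (zeroʳ a)
  ∑∈-const (inside  ∷ T) a = trans (+-congˡ (∑∈-const T a))
    (sym (trans (distribˡ a 1# _) (+-congʳ (*-identityʳ a))))
  ∑∈-const (outside ∷ T) a = trans (+-identityˡ _) (∑∈-const T a)

  ∑∈-nonpos : ∀ {n} (T : Subset n) {f : Fin n → Carrier} → (∀ {i} → i ∈ T → f i ≤ 0#) → ∑∈ T f ≤ 0#
  ∑∈-nonpos T f≤0 = ≤-trans (∑∈-mono T f≤0) (≤-reflexive (trans (∑∈-const T 0#) (zeroˡ _)))

  ∑∈-Empty : ∀ {n} (T : Subset n) {f : Fin n → Carrier} → Empty T → ∑∈ T f ≈ 0#
  ∑∈-Empty []            _       = refl
  ∑∈-Empty (inside  ∷ T) T-empty = contradiction (zero , here) T-empty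
  ∑∈-Empty (outside ∷ T) T-empty =
    trans (+-identityˡ _) (∑∈-Empty T (λ (i , i∈T) → T-empty (suc i , there i∈T)))

  ∑∈-remove : ∀ {n} (T : Subset n) {i} (f : Fin n → Carrier) → i ∈ T
    → ∑∈ T f ≈ f i + ∑∈ (T [ i ]≔ outside) f
  ∑∈-remove (_ ∷ T) f here        = +-congˡ (sym (+-identityˡ _))
  ∑∈-remove (_ ∷ T) f (there i∈T) = trans (+-congˡ (∑∈-remove T (f ∘ suc) i∈T)) (x+[y+z]≈y+[x+z] _ _ _)

  ∑∈-remove-nonpos : ∀ {n} (T : Subset n) {i} {f : Fin n → Carrier} → i ∈ T → f i ≤ 0#
    → ∑∈ T f ≤ ∑∈ (T [ i ]≔ outside) f
  ∑∈-remove-nonpos T {i} {f} i∈T fi≤0 = begin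
    ∑∈ T f                         ≈⟨ ∑∈-remove T f i∈T ⟩
    f i + ∑∈ (T [ i ]≔ outside) f  ≤⟨ +-monoˡ-≤ _ fi≤0 ⟩
    0# + ∑∈ (T [ i ]≔ outside) f   ≈⟨ +-identityˡ _ ⟩
    ∑∈ (T [ i ]≔ outside) f        ∎

  ∑∈²-remove-nonpos : ∀ {n} (T : Subset n) {i} {h : Fin n → Fin n → Carrier} → i ∈ T
    → (∀ {j} → j ∈ T → h i j ≤ 0#) → (∀ {j} → j ∈ T → h j i ≤ 0#)
    → ∑∈ T (λ j → ∑∈ T (h j)) ≤ ∑∈ (T [ i ]≔ outside) (λ j → ∑∈ (T [ i ]≔ outside) (h j))
  ∑∈²-remove-nonpos T {i} i∈T row≤0 column≤0 = ≤-trans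
    (∑∈-remove-nonpos T i∈T (∑∈-nonpos T row≤0))
    (∑∈-mono (T [ i ]≔ outside)
      (λ j∈T′ → ∑∈-remove-nonpos T i∈T (column≤0 (p[x]≔outside⊆p T i j∈T′))))

  ∑∈-shift : ∀ {n} (T : Subset n) a (f : Fin n → Carrier)
    → ∑∈ T f ≈ ∑∈ T (λ i → f i + - a) + a * fromℕ ∣ T ∣
  ∑∈-shift T a f = begin-equality
    ∑∈ T f                                    ≈⟨ ∑∈-cong T (λ {i} _ → //-rightDividesˡ a (f i)) ⟨
    ∑∈ T (λ i → f i + - a + a)                ≈⟨ ∑∈-+ T (λ i → f i + - a) (λ _ → a) ⟩
    ∑∈ T (λ i → f i + - a) + ∑∈ T (λ _ → a)   ≈⟨ +-congˡ (∑∈-const T a) ⟩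
    ∑∈ T (λ i → f i + - a) + a * fromℕ ∣ T ∣  ∎

  ∑∈-*-shift : ∀ {n} (T : Subset n) a (w f : Fin n → Carrier)
    → ∑∈ T (λ i → w i * f i) ≈ ∑∈ T (λ i → w i * (f i + - a)) + a * ∑∈ T w
  ∑∈-*-shift T a w f = begin-equality
    ∑∈ T (λ i → w i * f i)                              ≈⟨ ∑∈-cong T (λ {i} _ → split i) ⟩
    ∑∈ T (λ i → w i * (f i + - a) + a * w i)            ≈⟨ ∑∈-+ T _ _ ⟩
    ∑∈ T (λ i → w i * (f i + - a)) + ∑∈ T (λ i → a * w i) ≈⟨ +-congˡ (∑∈-*ˡ T a w) ⟩
    ∑∈ T (λ i → w i * (f i + - a)) + a * ∑∈ T w         ∎
    where
    split : ∀ i → w i * f i ≈ w i * (f i + - a) + a * w i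
    split i = begin-equality
      w i * f i                       ≈⟨ *-congˡ (//-rightDividesˡ a (f i)) ⟨
      w i * (f i + - a + a)           ≈⟨ distribˡ (w i) _ a ⟩
      w i * (f i + - a) + w i * a     ≈⟨ +-congˡ (*-comm (w i) a) ⟩
      w i * (f i + - a) + a * w i     ∎

  ∑∈+∑∉ : ∀ {n} (T : Subset n) (f : Fin n → Carrier) → ∑∈ T f + ∑∉ T f ≈ ∑ f
  ∑∈+∑∉ []            f = +-identityˡ 0#
  ∑∈+∑∉ (inside  ∷ T) f = trans (interchange _ _ _ _) (+-cong (+-identityʳ (f zero)) (∑∈+∑∉ T (f ∘ suc)))
  ∑∈+∑∉ (outside ∷ T) f = trans (interchange _ _ _ _) (+-cong (+-identityˡ (f zero)) (∑∈+∑∉ T (f ∘ suc)))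

  ∑∉≡∑∈∁ : ∀ {n} (T : Subset n) (f : Fin n → Carrier) → ∑∉ T f ≡ ∑∈ (∁ T) f
  ∑∉≡∑∈∁ []            f = ≡.refl
  ∑∉≡∑∈∁ (inside  ∷ T) f = ≡.cong (0# +_) (∑∉≡∑∈∁ T (f ∘ suc))
  ∑∉≡∑∈∁ (outside ∷ T) f = ≡.cong (f zero +_) (∑∉≡∑∈∁ T (f ∘ suc))

  minimum : ∀ {n} (y : Fin n → Carrier) (T : Subset n)
    → Empty T ⊎ ∃[ i ] (i ∈ T × (∀ {j} → j ∈ T → y i ≤ y j))
  minimum y []            = inj₁ (λ { (() , _) })
  minimum y (s ∷ T) with minimum (y ∘ suc) T
  minimum y (outside ∷ T) | inj₁ T-empty = inj₁ (λ { (suc i , there i∈T) → T-empty (i , i∈T) })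
  minimum y (inside  ∷ T) | inj₁ T-empty =
    inj₂ (zero , here , λ { here → ≤-refl ; (there j∈T) → contradiction (_ , j∈T) T-empty })
  minimum y (outside ∷ T) | inj₂ (i , i∈T , min) = inj₂ (suc i , there i∈T , λ { (there j∈T) → min j∈T })
  minimum y (inside  ∷ T) | inj₂ (i , i∈T , min) with total (y zero) (y (suc i))
  ... | inj₁ y₀≤yᵢ = inj₂ (zero , here , λ { here → ≤-refl ; (there j∈T) → ≤-trans y₀≤yᵢ (min j∈T) })
  ... | inj₂ yᵢ≤y₀ = inj₂ (suc i , there i∈T , λ { here → yᵢ≤y₀ ; (there j∈T) → min j∈T })

  weight : ∀ {n} → (Fin n → Fin n → Carrier) → Subset n → Carrier
  weight W V = ∑∈ V (λ i → ∑∈ V (W i))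

  weight-mono : ∀ {n} {W W′ : Fin n → Fin n → Carrier} (V : Subset n)
    → (∀ {i j} → i ∈ V → j ∈ V → W i j ≤ W′ i j) → weight W V ≤ weight W′ V
  weight-mono V W≤W′ = ∑∈-mono V (λ i∈V → ∑∈-mono V (W≤W′ i∈V))

  Sparse : ∀ {n} → (Fin n → Fin n → Carrier) → Carrier → Subset n → Set ℓ₂
  Sparse W κ T = ∀ {V} → V ⊆ T → weight W V ≤ κ * fromℕ ∣ V ∣

  module _ {n} (W : Fin n → Fin n → Carrier) (W-nonneg : ∀ i j → 0# ≤ W i j) (κ : Carrier) where

    LayerCakeBound : Subset n → Set (c ⊔ ℓ₂)
    LayerCakeBound T =
      Sparse W κ T
      → (y : Fin n → Carrier) → (∀ {i} → i ∈ T → 0# ≤ y i)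
      → (z : Fin n → Fin n → Carrier) → (∀ {i j} → i ∈ T → j ∈ T → z i j ≤ y i × z i j ≤ y j)
      → ∑∈ T (λ i → ∑∈ T (λ j → W i j * z i j)) ≤ κ * ∑∈ T y

    layer-cake-bound : ∀ {T} → LayerCakeBound T
    layer-cake-bound {T} = bound (<-wellFounded ∣ T ∣)
      where
      bound : ∀ {T} → Acc ℕ._<_ ∣ T ∣ → LayerCakeBound T
      bound {T} _ _ y _ z _ with minimum y T
      bound {T} _ _ y _ z _ | inj₁ T-empty = begin
        ∑∈ T (λ i → ∑∈ T (λ j → W i j * z i j)) ≈⟨ ∑∈-Empty T T-empty ⟩
        0#                                       ≈⟨ zeroʳ κ ⟨
        κ * 0#                                   ≈⟨ *-congˡ (∑∈-Empty T T-empty) ⟨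
        κ * ∑∈ T y                               ∎
      bound {T} (acc smaller) sparse y y-nonneg z z≤y | inj₂ (i₀ , i₀∈T , y-min) = begin
        ∑∈ T (λ i → ∑∈ T (λ j → W i j * z i j))
          ≈⟨ ∑∈-cong T (λ {i} _ → ∑∈-*-shift T m (W i) (z i)) ⟩
        ∑∈ T (λ i → ∑∈ T (λ j → W i j * z′ i j) + m * ∑∈ T (W i))
          ≈⟨ trans (∑∈-+ T _ _) (+-congˡ (∑∈-*ˡ T m _)) ⟩
        ∑∈ T (λ i → ∑∈ T (λ j → W i j * z′ i j)) + m * weight W T
          ≤⟨ +-mono-≤ (∑∈²-remove-nonpos T i₀∈T (λ j∈T → W*z′-nonpos (proj₁ (z≤y i₀∈T j∈T)))
                                                 (λ j∈T → W*z′-nonpos (proj₂ (z≤y j∈T i₀∈T))))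
                      (*-monoˡ-≤ (y-nonneg i₀∈T) (sparse ⊆-refl)) ⟩
        ∑∈ T′ (λ i → ∑∈ T′ (λ j → W i j * z′ i j)) + m * (κ * fromℕ ∣ T ∣)
          ≤⟨ +-monoˡ-≤ _ (bound (smaller (x∈p⇒∣p[x]≔outside∣<∣p∣ T i₀∈T))
                                (λ V⊆T′ → sparse (T′⊆T ∘ V⊆T′))
                                y′ (x≤y⇒0≤y-x ∘ y-min ∘ T′⊆T) z′ z′≤y′) ⟩
        κ * ∑∈ T′ y′ + m * (κ * fromℕ ∣ T ∣)
          ≈⟨ +-cong (*-congˡ (sym ∑∈T-y′≈∑∈T′-y′)) (x*[y*z]≈y*[x*z] m κ _) ⟩
        κ * ∑∈ T y′ + κ * (m * fromℕ ∣ T ∣)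
          ≈⟨ trans (sym (distribˡ κ _ _)) (*-congˡ (sym (∑∈-shift T m y))) ⟩
        κ * ∑∈ T y
          ∎
        where
        m : Carrier
        m = y i₀

        T′ : Subset n
        T′ = T [ i₀ ]≔ outside

        y′ : Fin n → Carrier
        y′ i = y i + - m

        z′ : Fin n → Fin n → Carrier
        z′ i j = z i j + - m

        T′⊆T : T′ ⊆ T
        T′⊆T = p[x]≔outside⊆p T i₀

        W*z′-nonpos : ∀ {i j} → z i j ≤ m → W i j * z′ i j ≤ 0#
        W*z′-nonpos {i} {j} z≤m =
          *-nonpos (W-nonneg i j) (≤-trans (+-monoˡ-≤ (- m) z≤m) (≤-reflexive (-‿inverseʳ m)))

        z′≤y′ : ∀ {i j} → i ∈ T′ → j ∈ T′ → z′ i j ≤ y′ i × z′ i j ≤ y′ j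
        z′≤y′ i∈T′ j∈T′ = map (+-monoˡ-≤ (- m)) (+-monoˡ-≤ (- m)) (z≤y (T′⊆T i∈T′) (T′⊆T j∈T′))

        ∑∈T-y′≈∑∈T′-y′ : ∑∈ T y′ ≈ ∑∈ T′ y′
        ∑∈T-y′≈∑∈T′-y′ = trans (∑∈-remove T y′ i₀∈T) (trans (+-congʳ (-‿inverseʳ m)) (+-identityˡ _))

  ∑∉²≈∑∈∁² : ∀ {n} (T : Subset n) (h : Fin n → Fin n → Carrier)
    → ∑∉ T (λ i → ∑∉ T (h i)) ≈ ∑∈ (∁ T) (λ i → ∑∈ (∁ T) (h i))
  ∑∉²≈∑∈∁² T h =
    trans (reflexive (∑∉≡∑∈∁ T _)) (∑∈-cong (∁ T) (λ {i} _ → reflexive (∑∉≡∑∈∁ T (h i))))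

  x*[k-s]≈x*k*[1-k⁻¹*s] : ∀ x k s → (k ≡ 0 → s ≈ 0#)
    → x * (fromℕ k + - s) ≈ x * fromℕ k * (1# + - (fromℕ k ⁻¹ * s))
  x*[k-s]≈x*k*[1-k⁻¹*s] x k s s≈0 = begin-equality
    x * (K + - s)                      ≈⟨ *-congˡ (+-congˡ (-‿cong (fromℕ*[fromℕ⁻¹*s]≈s k s s≈0))) ⟨
    x * (K + - (K * (K ⁻¹ * s)))       ≈⟨ *-congˡ (+-cong (sym (*-identityʳ K)) (-‿distribʳ-* K _)) ⟩
    x * (K * 1# + K * - (K ⁻¹ * s))    ≈⟨ *-congˡ (distribˡ K 1# _) ⟨
    x * (K * (1# + - (K ⁻¹ * s)))      ≈⟨ *-assoc x K _ ⟨
    x * K * (1# + - (K ⁻¹ * s))        ∎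
    where
    K = fromℕ k

  DkS⇒∁-sparse : ∀ {n} k d δ γ S (A : Fin n → Fin n → Carrier)
    → IsDkSInstance n k d δ γ S A → Sparse A ((1# + 1#) * γ * d) (∁ S)
  DkS⇒∁-sparse k d δ γ S A (A₀ , (_ , A₀-nonneg) , _ , _ , _ , ρ₀-bound , _ , kept-or-deleted) {V} V⊆∁S =
    begin
      weight A V                         ≤⟨ weight-mono V A≤A₀ ⟩
      weight A₀ V                        ≈⟨ 2*[½*x]≈x _ ⟨
      (1# + 1#) * ρ A₀ V                 ≤⟨ *-monoˡ-≤ 0≤1+1 (ρ₀-bound V V-outside-S) ⟩
      (1# + 1#) * (γ * d * fromℕ ∣ V ∣)  ≈⟨ reassociate ⟨
      (1# + 1#) * γ * d * fromℕ ∣ V ∣    ∎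
    where
    reassociate : (1# + 1#) * γ * d * fromℕ ∣ V ∣ ≈ (1# + 1#) * (γ * d * fromℕ ∣ V ∣)
    reassociate = trans (*-assoc _ d _) (trans (*-assoc _ γ _) (*-congˡ (sym (*-assoc γ d _))))


    0≤1+1 : 0# ≤ 1# + 1#
    0≤1+1 = ≤-trans (≤-reflexive (sym (+-identityˡ 0#))) (+-mono-≤ 0≤1 0≤1)

    not-both : ∀ {i j} → i ∈ V → ¬ (lookup S i ≡ true × lookup S j ≡ true)
    not-both i∈V (Sᵢ , _) = not-¬ (∈∁⇒lookup≡false (V⊆∁S i∈V)) Sᵢ

    V-outside-S : V ⊆∁ S
    V-outside-S i Vᵢ = ∈∁⇒lookup≡false (V⊆∁S (lookup⇒[]= i V Vᵢ))

    A≤A₀ : ∀ {i j} → i ∈ V → j ∈ V → A i j ≤ A₀ i j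
    A≤A₀ i∈V _ = kept-or-deleted⇒≤ (kept-or-deleted _ _ (not-both i∈V)) (A₀-nonneg _ _)

  feasible⇒⟨⟩≤‖‖² : ∀ {n} k m X I → IsFeasible n k m X I
    → ∀ i j → ⟨ X i , X j ⟩ ≤ ‖ X i ‖² × ⟨ X i , X j ⟩ ≤ ‖ X j ‖²
  feasible⇒⟨⟩≤‖‖² k m X I (_ , _ , off-diagonal , _) i j =
    ⟨⟩≤‖‖²ˡ i j , ≤-trans (≤-reflexive (⟨⟩-comm (X i) (X j))) (⟨⟩≤‖‖²ˡ j i)
    where
    ⟨⟩≤‖‖²ˡ : ∀ i j → ⟨ X i , X j ⟩ ≤ ‖ X i ‖²
    ⟨⟩≤‖‖²ˡ i j with i ≟ j
    ... | yes ≡.refl = ≤-refl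
    ... | no i≢j     = proj₂ (off-diagonal i j i≢j)

  feasible⇒∑∉‖‖² : ∀ {n} k m X I → IsFeasible n k m X I
    → ∀ S → ∑∉ S (λ i → ‖ X i ‖²) ≈ fromℕ k + - ∑∈ S (λ i → ‖ X i ‖²)
  feasible⇒∑∉‖‖² k m X I (∑‖X‖²≈k , _) S = begin-equality
    u              ≈⟨ \\-leftDividesʳ s u ⟨
    - s + (s + u)  ≈⟨ +-congˡ (trans (∑∈+∑∉ S _) ∑‖X‖²≈k) ⟩
    - s + fromℕ k  ≈⟨ +-comm (- s) _ ⟩
    fromℕ k + - s  ∎
    where
    s = ∑∈ S _
    u = ∑∉ S _

proposition3p11 : ∀ {c ℓ₁ ℓ₂ : Level} (F : OrderedField c ℓ₁ ℓ₂)
    → let open OrderedField F in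
      (n k : ℕ) (d δ γ : Carrier) → k Data.Nat.< n
    → 0# < d → 0# < δ → δ < 1# → 0# ≤ γ
    → (S : Subset n) → ∣ S ∣ ≡ k
    → (A : Fin n → Fin n → Carrier) → IsDkSInstance n k d δ γ S A
    → (m : ℕ) (X : Fin n → Fin m → Carrier) (I : Fin m → Carrier)
    → IsFeasible n k m X I
    → ∑∉ S (λ i → ∑∉ S (λ j → A i j * ⟨ X i , X j ⟩))
        ≤ (((1# + 1#) * γ) * d * fromℕ k) * (1# + - 𝔼 k S (λ i → ‖ X i ‖²))
-- Only step (3), the fact that the adversary only deletes, and
-- ⟨X_i, X_j⟩ ≤ ‖X_i‖² are needed; the remaining hypotheses are unused.
proposition3p11 F n k d δ γ _ _ _ _ _ S ∣S∣≡k A dks@(_ , _ , (_ , A-nonneg) , _) m X I feasible = begin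
  ∑∉ S (λ i → ∑∉ S (λ j → A i j * ⟨ X i , X j ⟩))
    ≈⟨ ∑∉²≈∑∈∁² S _ ⟩
  ∑∈ (∁ S) (λ i → ∑∈ (∁ S) (λ j → A i j * ⟨ X i , X j ⟩))
    ≤⟨ layer-cake-bound A A-nonneg κ (DkS⇒∁-sparse k d δ γ S A dks)
                        x (λ {i} _ → ‖‖²-nonneg (X i)) (λ i j → ⟨ X i , X j ⟩) ⟨⟩≤x ⟩
  κ * ∑∈ (∁ S) x
    ≈⟨ *-congˡ ∑∈∁S-x ⟩
  κ * (fromℕ k + - ∑∈ S x)
    ≈⟨ x*[k-s]≈x*k*[1-k⁻¹*s] κ k _ (λ k≡0 → ∑∈-Empty S (∣p∣≡0⇒Empty S (≡.trans ∣S∣≡k k≡0))) ⟩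
  κ * fromℕ k * (1# + - 𝔼 k S x)
    ∎
  where
  open OrderedField F
  open OrderedFieldProperties F
  open ≤-Reasoning poset
  open CommutativeRing commutativeRing using (trans; reflexive; *-congˡ)

  κ : Carrier
  κ = (1# + 1#) * γ * d

  x : Fin n → Carrier
  x i = ‖ X i ‖²

  ⟨⟩≤x : ∀ {i j} → i ∈ ∁ S → j ∈ ∁ S → ⟨ X i , X j ⟩ ≤ x i × ⟨ X i , X j ⟩ ≤ x j
  ⟨⟩≤x {i} {j} _ _ = feasible⇒⟨⟩≤‖‖² k m X I feasible i j

  ∑∈∁S-x : ∑∈ (∁ S) x ≈ fromℕ k + - ∑∈ S x
  ∑∈∁S-x = trans (reflexive (≡.sym (∑∉≡∑∈∁ S x))) (feasible⇒∑∉‖‖² k m X I feasible S)
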